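{- Let $G$ be a connected graph with a root vertex $r$, and let $\phi$ be an atomic edge-coloring of $G$. Then $\phi$ is a strong parity edge-coloring if and only if $S_u\cap S_v=\varnothing$ for all distinct vertices $u,v\in V(G)$.
   Context: $\mathbb{U}$ is the vector space over $\mathbb{F}_2$ of binary sequences with finitely many $1$s (componentwise addition). An atom is a vector of $\mathbb{U}$ with exactly one coordinate equal to $1$; an atomic edge-coloring assigns an atom to each edge (an arbitrary edge-coloring by positive integers is encoded this way by sending color $c$ to the atom with its $1$ in coordinate $c$). For a walk $W$ with edges $e_1,\dots,e_t$ in order, $\phi(W)=\phi(e_1)+\cdots+\phi(e_t)$ in $\mathbb{U}$. For $v\in V(G)$, $S_v=\{\phi(W): W \text{ is a walk from } r \text{ to } v\}$. A walk is a parity walk if each color appears an even number of times along it (with multiplicity), and open if its endpoints are distinct; a strong parity edge-coloring is an edge-coloring with no open parity walk. -}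

module Defs where

open import Data.Nat using (ℕ; zero; suc; _≡ᵇ_)
open import Data.Nat.Divisibility using (_∣_)
open import Data.Bool using (Bool; false; true; _xor_; if_then_else_)
open import Data.Fin using (Fin)
open import Data.List using (List; []; _∷_)
open import Data.Product using (Σ; _×_; ∃)
open import Relation.Binary.PropositionalEquality using (_≡_; _≢_)
open import Relation.Nullary using (¬_)

record Graph (n : ℕ) : Set₁ where
  field
    Adj     : Fin n → Fin n → Set
    sym     : ∀ {u v} → Adj u v → Adj v u
    irrefl  : ∀ {u} → ¬ Adj u u
open Graph public

data Walk {n : ℕ} (G : Graph n) : Fin n → Fin n → Set where
  nil  : ∀ {u} → Walk G u u
  cons : ∀ {u w v} → Adj G u w → Walk G w v → Walk G u v

Connected : ∀ {n} → Graph n → Set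
Connected G = ∀ u v → Walk G u v

-- An edge-coloring by natural-number colors: a function on ordered vertex pairs
-- whose value on an edge uv does not depend on the orientation.
-- (Its values on non-adjacent pairs are irrelevant.)
record EdgeColoring {n : ℕ} (G : Graph n) : Set₁ where
  field
    col     : Fin n → Fin n → ℕ
    col-sym : ∀ {u v} → Adj G u v → col u v ≡ col v u
open EdgeColoring public

colors : ∀ {n} {G : Graph n} → EdgeColoring G → ∀ {u v} → Walk G u v → List ℕ
colors φ nil = []
colors φ (cons {u} {w} _ W) = col φ u w ∷ colors φ W

𝕌 : Set
𝕌 = ℕ → Bool

𝟘 : 𝕌
𝟘 _ = false

_⊕_ : 𝕌 → 𝕌 → 𝕌
(x ⊕ y) i = x i xor y i

-- The atom with its 1 in coordinate c (encoding of color c).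
atom : ℕ → 𝕌
atom c i = i ≡ᵇ c

sumAtoms : List ℕ → 𝕌
sumAtoms [] = 𝟘
sumAtoms (c ∷ cs) = atom c ⊕ sumAtoms cs

φW : ∀ {n} {G : Graph n} → EdgeColoring G → ∀ {u v} → Walk G u v → 𝕌
φW φ W = sumAtoms (colors φ W)

_≈𝕌_ : 𝕌 → 𝕌 → Set
x ≈𝕌 y = ∀ i → x i ≡ y i

_∈S[_,_,_] : ∀ {n} {G : Graph n} → 𝕌 → EdgeColoring G → Fin n → Fin n → Set
_∈S[_,_,_] {G = G} x φ r v = Σ (Walk G r v) (λ W → φW φ W ≈𝕌 x)

DisjointS : ∀ {n} {G : Graph n} → EdgeColoring G → Fin n → Fin n → Fin n → Set
DisjointS φ r u v = ¬ Σ 𝕌 (λ x → (x ∈S[ φ , r , u ]) × (x ∈S[ φ , r , v ]))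

occ : ℕ → List ℕ → ℕ
occ c [] = zero
occ c (d ∷ ds) = if c ≡ᵇ d then suc (occ c ds) else occ c ds

ParityWalk : ∀ {n} {G : Graph n} → EdgeColoring G → ∀ {u v} → Walk G u v → Set
ParityWalk φ W = ∀ c → 2 ∣ occ c (colors φ W)

StrongParity : ∀ {n} {G : Graph n} → EdgeColoring G → Set
StrongParity {G = G} φ = ∀ u v → u ≢ v → (W : Walk G u v) → ¬ ParityWalk φ W

-- Values of walks add under concatenation and are invariant under reversal,
-- and a walk is a parity walk exactly when its value is 0. Hence two walks
-- from r to u ≠ v with a common value x give the open parity walk W₁⁻¹W₂
-- (value x + x = 0), and conversely an open parity walk W from u to v turns
-- any walk P from r to u into the walk PW to v with the same value as P.
module Submission where

open import Defs
open import Data.Nat using (ℕ; zero; suc; _≡ᵇ_; _*_)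
open import Data.Nat.Divisibility using (_∣_; divides)
open import Data.Bool using (Bool; true; false; _xor_; not)
open import Data.Bool.Properties using (xor-comm; xor-assoc; xor-identityʳ; xor-same)
open import Data.Fin using (Fin)
open import Data.List using ([]; _∷_; _++_)
open import Data.Product using (_×_; _,_)
open import Relation.Binary.PropositionalEquality
  using (_≡_; _≢_; refl; cong; cong₂; trans; module ≡-Reasoning)
  renaming (sym to ≡-sym)

module _ {n : ℕ} {G : Graph n} where

  infixr 5 _++ʷ_

  _++ʷ_ : ∀ {u v w} → Walk G u v → Walk G v w → Walk G u w
  nil      ++ʷ V = V
  cons a W ++ʷ V = cons a (W ++ʷ V)

  reverse : ∀ {u v} → Walk G u v → Walk G v u
  reverse nil        = nil
  reverse (cons a W) = reverse W ++ʷ cons (sym G a) nil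

sumAtoms-++ : ∀ cs ds → sumAtoms (cs ++ ds) ≈𝕌 (sumAtoms cs ⊕ sumAtoms ds)
sumAtoms-++ []       ds i = refl
sumAtoms-++ (c ∷ cs) ds i = trans (cong (atom c i xor_) (sumAtoms-++ cs ds i))
  (≡-sym (xor-assoc (atom c i) (sumAtoms cs i) (sumAtoms ds i)))

module _ {n : ℕ} {G : Graph n} (φ : EdgeColoring G) where

  colors-++ʷ : ∀ {u v w} (W : Walk G u v) (V : Walk G v w) →
               colors φ (W ++ʷ V) ≡ colors φ W ++ colors φ V
  colors-++ʷ nil        V = refl
  colors-++ʷ (cons a W) V = cong (_ ∷_) (colors-++ʷ W V)

  φW-++ʷ : ∀ {u v w} (W : Walk G u v) (V : Walk G v w) →
           φW φ (W ++ʷ V) ≈𝕌 (φW φ W ⊕ φW φ V)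
  φW-++ʷ W V i rewrite colors-++ʷ W V = sumAtoms-++ (colors φ W) (colors φ V) i

  φW-reverse : ∀ {u v} (W : Walk G u v) → φW φ (reverse W) ≈𝕌 φW φ W
  φW-reverse nil i = refl
  φW-reverse (cons {u} {w} a W) i = begin
    φW φ (reverse W ++ʷ cons (sym G a) nil) i   ≡⟨ φW-++ʷ (reverse W) (cons (sym G a) nil) i ⟩
    φW φ (reverse W) i xor (atom (col φ w u) i xor false)
      ≡⟨ cong₂ _xor_ (φW-reverse W i) (xor-identityʳ (atom (col φ w u) i)) ⟩
    φW φ W i xor atom (col φ w u) i             ≡⟨ cong (λ c → φW φ W i xor atom c i) (≡-sym (col-sym φ a)) ⟩
    φW φ W i xor atom (col φ u w) i             ≡⟨ xor-comm (φW φ W i) (atom (col φ u w) i) ⟩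
    atom (col φ u w) i xor φW φ W i             ∎
    where open ≡-Reasoning

odd : ℕ → Bool
odd zero          = false
odd (suc zero)    = true
odd (suc (suc m)) = odd m

odd-suc : ∀ m → odd (suc m) ≡ not (odd m)
odd-suc zero          = refl
odd-suc (suc zero)    = refl
odd-suc (suc (suc m)) = odd-suc m

odd≡false⇒2∣ : ∀ m → odd m ≡ false → 2 ∣ m
odd≡false⇒2∣ zero          _ = divides 0 refl
odd≡false⇒2∣ (suc (suc m)) e with odd≡false⇒2∣ m e
... | divides q m≡q*2 = divides (suc q) (cong (λ k → suc (suc k)) m≡q*2)

2∣⇒odd≡false : ∀ m → 2 ∣ m → odd m ≡ false
2∣⇒odd≡false _ (divides q refl) = odd-q*2 q
  where
  odd-q*2 : ∀ q → odd (q * 2) ≡ false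
  odd-q*2 zero    = refl
  odd-q*2 (suc q) = odd-q*2 q

sumAtoms≡odd-occ : ∀ cs c → sumAtoms cs c ≡ odd (occ c cs)
sumAtoms≡odd-occ []       c = refl
sumAtoms≡odd-occ (d ∷ cs) c with c ≡ᵇ d
... | true  = trans (cong not (sumAtoms≡odd-occ cs c)) (≡-sym (odd-suc (occ c cs)))
... | false = sumAtoms≡odd-occ cs c

module _ {n : ℕ} {G : Graph n} (φ : EdgeColoring G) where

  φW≈𝟘⇒parityWalk : ∀ {u v} (W : Walk G u v) → φW φ W ≈𝕌 𝟘 → ParityWalk φ W
  φW≈𝟘⇒parityWalk W φW≈𝟘 c =
    odd≡false⇒2∣ _ (trans (≡-sym (sumAtoms≡odd-occ (colors φ W) c)) (φW≈𝟘 c))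

  parityWalk⇒φW≈𝟘 : ∀ {u v} (W : Walk G u v) → ParityWalk φ W → φW φ W ≈𝕌 𝟘
  parityWalk⇒φW≈𝟘 W par c =
    trans (sumAtoms≡odd-occ (colors φ W) c) (2∣⇒odd≡false _ (par c))

  parityWalk-reverse-++ʷ : ∀ {r u v} (W₁ : Walk G r u) (W₂ : Walk G r v) →
                           φW φ W₁ ≈𝕌 φW φ W₂ → ParityWalk φ (reverse W₁ ++ʷ W₂)
  parityWalk-reverse-++ʷ W₁ W₂ W₁≈W₂ = φW≈𝟘⇒parityWalk (reverse W₁ ++ʷ W₂) λ i → begin
    φW φ (reverse W₁ ++ʷ W₂) i        ≡⟨ φW-++ʷ φ (reverse W₁) W₂ i ⟩
    φW φ (reverse W₁) i xor φW φ W₂ i ≡⟨ cong (_xor φW φ W₂ i) (trans (φW-reverse φ W₁ i) (W₁≈W₂ i)) ⟩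
    φW φ W₂ i xor φW φ W₂ i           ≡⟨ xor-same (φW φ W₂ i) ⟩
    false                             ∎
    where open ≡-Reasoning

  φW-++ʷ-parityWalk : ∀ {r u v} (P : Walk G r u) (W : Walk G u v) →
                      ParityWalk φ W → φW φ (P ++ʷ W) ≈𝕌 φW φ P
  φW-++ʷ-parityWalk P W par i = begin
    φW φ (P ++ʷ W) i         ≡⟨ φW-++ʷ φ P W i ⟩
    φW φ P i xor φW φ W i    ≡⟨ cong (φW φ P i xor_) (parityWalk⇒φW≈𝟘 W par i) ⟩
    φW φ P i xor false       ≡⟨ xor-identityʳ (φW φ P i) ⟩
    φW φ P i                 ∎
    where open ≡-Reasoning

lemma2p4 : ∀ {n} (G : Graph n) (r : Fin n) (φ : EdgeColoring G) →
    Connected G →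
    (StrongParity φ → ∀ u v → u ≢ v → DisjointS φ r u v) ×
    ((∀ u v → u ≢ v → DisjointS φ r u v) → StrongParity φ)
lemma2p4 G r φ connected = strong⇒disjoint , disjoint⇒strong
  where
  strong⇒disjoint : StrongParity φ → ∀ u v → u ≢ v → DisjointS φ r u v
  strong⇒disjoint strong u v u≢v (x , (W₁ , W₁≈x) , (W₂ , W₂≈x)) =
    strong u v u≢v (reverse W₁ ++ʷ W₂)
      (parityWalk-reverse-++ʷ φ W₁ W₂ (λ i → trans (W₁≈x i) (≡-sym (W₂≈x i))))

  disjoint⇒strong : (∀ u v → u ≢ v → DisjointS φ r u v) → StrongParity φ
  disjoint⇒strong disjoint u v u≢v W par =
    disjoint u v u≢v (φW φ P , (P , λ _ → refl) , (P ++ʷ W , φW-++ʷ-parityWalk φ P W par))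
    where P = connected r u
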